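{- Let $\hat P\subseteq[0,1]^n$ be the feasible region of a linear program given by a system of linear inequalities $\sum_{i=1}^n a_iy_i\ge b$ over variables $y_1,\dots,y_n$ (including the constraints $0\le y_i\le1$). Call a constraint positive if $b>0$. Let $C\subseteq\{1,\dots,n\}$ be a set of indices that does not contain the support $\{i:a_i\ne0\}$ of any positive constraint. Let $\hat P_C$ be the feasible region of the linear program obtained by removing all variables with indices in $C$ from the constraints of the linear program of $\hat P$. Let $t\ge0$ be an integer. Then for every $y\in SA^t(\hat P_C)$ there is a $y'\in SA^t(\hat P)$; specifically, $y'$ defined by $y'_S=y_S$ if $S\cap C=\emptyset$ and $y'_S=0$ otherwise (for all $S\subseteq\{1,\dots,n\}$, $|S|\le t+1$) lies in $SA^t(\hat P)$.
   Context: Sherali–Adams: for a polytope given by a finite system of linear inequalities $\sum_i a_iy_i\ge b$ over variables indexed by a set $I$ (including $0\le y_i\le1$; equations written as two inequalities), and integer $t\ge0$, the level-$t$ Sherali–Adams tightening is the set of vectors $y=(y_S)$ indexed by subsets $S\subseteq I$ with $|S|\le t+1$, with $y_\emptyset=1$, such that for every inequality of the system and every pair of disjoint $S,Q\subseteq I$ with $|S|+|Q|\le t$: $\sum_{i} a_i\sum_{T\subseteq Q}(-1)^{|T|}y_{S\cup T\cup\{i\}}\ge b\sum_{T\subseteq Q}(-1)^{|T|}y_{S\cup T}$. For $\hat P_C$ the index set is $\{1,\dots,n\}-C$.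
   Formalization: The coefficients $a_i$ and $b$ of the constraints and the entries $y_S$ of the Sherali–Adams vectors are rational instead of real. -}

module Defs where

open import Data.Nat using (ℕ; zero; suc; _+_; _≤_)
open import Data.Bool using (Bool; true; false; if_then_else_)
open import Data.Fin using (Fin; zero; suc)
import Data.Fin.Properties as FinP
open import Data.Fin.Subset using (Subset; _∈_; _⊆_; _∪_; _∩_; ⁅_⁆; ∣_∣; ⊥; ⊤; ∁; inside; outside)
open import Data.Vec using (Vec; []; _∷_; lookup; tabulate)
open import Data.List using (List; []; _∷_; map; _++_; foldr)
import Data.List.Membership.Propositional as LM
open import Data.Product using (_×_; _,_)
open import Data.Rational using (ℚ; 0ℚ; 1ℚ; -_) renaming (_+_ to _+ℚ_; _*_ to _*ℚ_; _≤_ to _≤ℚ_; _<_ to _<ℚ_)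
open import Relation.Nullary using (¬_; ⌊_⌋)
open import Relation.Binary.PropositionalEquality using (_≡_; _≢_)

-- A linear constraint  Σ_i a_i y_i ≥ b  over variables y_1..y_n (indexed by Fin n):
-- the pair (a , b) with coefficient vector a.
Constraint : ℕ → Set
Constraint n = Vec ℚ n × ℚ

System : ℕ → Set
System n = List (Constraint n)

Σ-Fin : ∀ {n} → (Fin n → ℚ) → ℚ
Σ-Fin {zero}  f = 0ℚ
Σ-Fin {suc n} f = f zero +ℚ Σ-Fin (λ i → f (suc i))

Σ-in : ∀ {n} → Subset n → (Fin n → ℚ) → ℚ
Σ-in I f = Σ-Fin (λ i → if lookup I i then f i else 0ℚ)

subsetsOf : ∀ {n} → Subset n → List (Subset n)
subsetsOf []            = [] ∷ []
subsetsOf (false ∷ q) = map (outside ∷_) (subsetsOf q)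
subsetsOf (true ∷ q)  = map (outside ∷_) (subsetsOf q) ++ map (inside ∷_) (subsetsOf q)

sumList : List ℚ → ℚ
sumList = foldr _+ℚ_ 0ℚ

sgn : ℕ → ℚ
sgn zero    = 1ℚ
sgn (suc k) = - sgn k

altSum : ∀ {n} → Subset n → (Subset n → ℚ) → ℚ
altSum Q g = sumList (map (λ T → sgn ∣ T ∣ *ℚ g T) (subsetsOf Q))

-- A vector y = (y_S)_{S ⊆ I, |S| ≤ t+1} is
-- represented by a function on all subsets of Fin n; only the entries at
-- S ⊆ I with |S| ≤ t+1 are constrained (the others are irrelevant).
SA : ∀ {n} → (I : Subset n) → System n → ℕ → (Subset n → ℚ) → Set
SA {n} I sys t y =
  (y ⊥ ≡ 1ℚ) ×
  (∀ {a b} → (a , b) LM.∈ sys →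
   ∀ (S Q : Subset n) → S ⊆ I → Q ⊆ I → S ∩ Q ≡ ⊥ → ∣ S ∣ + ∣ Q ∣ ≤ t →
   b *ℚ altSum Q (λ T → y (S ∪ T))
     ≤ℚ Σ-in I (λ i → lookup a i *ℚ altSum Q (λ T → y (S ∪ T ∪ ⁅ i ⁆))))

unitVec : ∀ {n} → Fin n → Vec ℚ n
unitVec i = tabulate (λ j → if ⌊ i FinP.≟ j ⌋ then 1ℚ else 0ℚ)

negUnitVec : ∀ {n} → Fin n → Vec ℚ n
negUnitVec i = tabulate (λ j → if ⌊ i FinP.≟ j ⌋ then - 1ℚ else 0ℚ)

ContainsBox : ∀ {n} → System n → Set
ContainsBox {n} sys = ∀ (i : Fin n) → ((unitVec i , 0ℚ) LM.∈ sys) × ((negUnitVec i , - 1ℚ) LM.∈ sys)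

NoPositiveSupportIn : ∀ {n} → System n → Subset n → Set
NoPositiveSupportIn {n} sys C =
  ∀ {a b} → (a , b) LM.∈ sys → 0ℚ <ℚ b →
  ¬ (∀ (i : Fin n) → lookup a i ≢ 0ℚ → i ∈ C)

-- Remove the variables with indices in C from a constraint (their
-- coefficients are dropped; the resulting system lives on the index set ∁ C).
removeVars : ∀ {n} → Subset n → System n → System n
removeVars C = map (λ { (a , b) → (tabulate (λ i → if lookup C i then 0ℚ else lookup a i) , b) })

disjoint? : ∀ {n} → Subset n → Subset n → Bool
disjoint? []      []      = true
disjoint? (true ∷ s) (true ∷ c) = false
disjoint? (true ∷ s) (false ∷ c) = disjoint? s c
disjoint? (false ∷ s) (_ ∷ c) = disjoint? s c

extendByZero : ∀ {n} → Subset n → (Subset n → ℚ) → Subset n → ℚ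
extendByZero C y S = if disjoint? S C then y S else 0ℚ

{-# OPTIONS --safe #-}
-- In the Sherali–Adams inequality indexed by (S, Q), every entry of y′ is y′ at a
-- set S ∪ T or S ∪ T ∪ {i} with T ⊆ Q. If S meets C all these entries vanish and
-- the inequality reads 0 ≤ 0. Otherwise the terms of the alternating sum with T
-- meeting C vanish, leaving the alternating sum over T ⊆ Q − C, and the summands
-- with i ∈ C vanish, which is exactly where the reduced system has coefficient 0.
-- So the inequality for y′ at (S, Q) is the inequality of SA^t(P̂_C) for y at
-- (S, Q − C).
module Submission where

open import Defs
open import Data.Nat using (ℕ; zero; suc; _+_; _≤_)
open import Data.Fin.Subset using (Subset; ⊤; ∁; _∪_; _∩_; ⁅_⁆; ∣_∣; _⊆_; inside; outside) renaming (⊥ to ∅)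
open import Data.Rational using (ℚ)

open import Data.Bool using (true; false; _∧_; not; if_then_else_)
open import Data.Bool.Properties using (∧-zeroʳ; ∧-identityʳ)
open import Data.Fin using (Fin; zero; suc)
open import Data.Fin.Subset.Properties using (∩-assoc; ∩-zeroˡ; ∣p∩q∣≤∣p∣; p∩q⊆q)
open import Data.Vec using (Vec; []; _∷_; here; there; lookup; tabulate)
open import Data.Vec.Properties using (lookup-replicate; lookup-map; lookup∘tabulate)
open import Data.List using (List; []; _∷_; map; _++_)
open import Data.List.Properties using (map-++; map-cong; map-∘)
open import Data.List.Membership.Propositional using (_∈_)
open import Data.List.Membership.Propositional.Properties using (∈-map⁺)
import Data.Nat.Properties as ℕ
open import Data.Product using (_,_)
open import Data.Rational using (0ℚ; 1ℚ; -_) renaming (_+_ to _+ℚ_; _*_ to _*ℚ_; _≤_ to _≤ℚ_)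
open import Data.Rational.Properties using (+-identityˡ; +-identityʳ; +-assoc; *-zeroʳ; neg-distrib-+; neg-distribˡ-*; ≤-reflexive)
open import Relation.Binary.PropositionalEquality
open ≡-Reasoning

sumList-++ : ∀ xs ys → sumList (xs ++ ys) ≡ sumList xs +ℚ sumList ys
sumList-++ []       ys = sym (+-identityˡ (sumList ys))
sumList-++ (x ∷ xs) ys = trans (cong (x +ℚ_) (sumList-++ xs ys)) (sym (+-assoc x (sumList xs) (sumList ys)))

Σ-Fin-cong : ∀ {n} {f g : Fin n → ℚ} → (∀ i → f i ≡ g i) → Σ-Fin f ≡ Σ-Fin g
Σ-Fin-cong {zero}  f≗g = refl
Σ-Fin-cong {suc n} {f} {g} f≗g =
  cong₂ _+ℚ_ (f≗g zero) (Σ-Fin-cong {f = λ i → f (suc i)} {g = λ i → g (suc i)} (λ i → f≗g (suc i)))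

Σ-Fin-zero : ∀ {n} {f : Fin n → ℚ} → (∀ i → f i ≡ 0ℚ) → Σ-Fin f ≡ 0ℚ
Σ-Fin-zero {zero}  f≗0 = refl
Σ-Fin-zero {suc n} {f} f≗0 = cong₂ _+ℚ_ (f≗0 zero) (Σ-Fin-zero {f = λ i → f (suc i)} (λ i → f≗0 (suc i)))

Σ-in-zero : ∀ {n} (I : Subset n) {f : Fin n → ℚ} → (∀ i → f i ≡ 0ℚ) → Σ-in I f ≡ 0ℚ
Σ-in-zero I {f} f≗0 = Σ-Fin-zero vanish
  where
  vanish : ∀ i → (if lookup I i then f i else 0ℚ) ≡ 0ℚ
  vanish i with lookup I i
  ... | true  = f≗0 i
  ... | false = refl

Σ-in-⊤-∁ : ∀ {n} (C : Subset n) {f g : Fin n → ℚ} →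
           (∀ i → f i ≡ (if lookup C i then 0ℚ else g i)) → Σ-in ⊤ f ≡ Σ-in (∁ C) g
Σ-in-⊤-∁ C {f} {g} f≗g∖C = Σ-Fin-cong termwise
  where
  termwise : ∀ i → (if lookup ⊤ i then f i else 0ℚ) ≡ (if lookup (∁ C) i then g i else 0ℚ)
  termwise i rewrite lookup-replicate i inside | lookup-map i not C with lookup C i | f≗g∖C i
  ... | true  | fi≡0  = fi≡0
  ... | false | fi≡gi = fi≡gi


signedTerm : ∀ {n} → (Subset n → ℚ) → Subset n → ℚ
signedTerm g T = sgn ∣ T ∣ *ℚ g T

altSum-cong : ∀ {n} (Q : Subset n) {g h : Subset n → ℚ} → (∀ T → g T ≡ h T) → altSum Q g ≡ altSum Q h
altSum-cong Q g≗h = cong sumList (map-cong (λ T → cong (sgn ∣ T ∣ *ℚ_) (g≗h T)) (subsetsOf Q))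

altSum-outside : ∀ {n} (Q : Subset n) (g : Subset (suc n) → ℚ) →
                 altSum (outside ∷ Q) g ≡ altSum Q (λ T → g (outside ∷ T))
altSum-outside Q g = cong sumList (sym (map-∘ (subsetsOf Q)))

signedSum-inside : ∀ {n} (g : Subset (suc n) → ℚ) (Ts : List (Subset n)) →
                   sumList (map (signedTerm g) (map (inside ∷_) Ts))
                     ≡ - sumList (map (signedTerm (λ T → g (inside ∷ T))) Ts)
signedSum-inside g []       = refl
signedSum-inside g (T ∷ Ts) =
  trans (cong₂ _+ℚ_ (sym (neg-distribˡ-* (sgn ∣ T ∣) (g (inside ∷ T)))) (signedSum-inside g Ts))
        (sym (neg-distrib-+ (signedTerm (λ T → g (inside ∷ T)) T) _))

altSum-inside : ∀ {n} (Q : Subset n) (g : Subset (suc n) → ℚ) →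
                altSum (inside ∷ Q) g ≡ altSum Q (λ T → g (outside ∷ T)) +ℚ - altSum Q (λ T → g (inside ∷ T))
altSum-inside Q g = begin
  sumList (map (signedTerm g) (map (outside ∷_) Ts ++ map (inside ∷_) Ts))
    ≡⟨ cong sumList (map-++ (signedTerm g) (map (outside ∷_) Ts) _) ⟩
  sumList (map (signedTerm g) (map (outside ∷_) Ts) ++ map (signedTerm g) (map (inside ∷_) Ts))
    ≡⟨ sumList-++ (map (signedTerm g) (map (outside ∷_) Ts)) _ ⟩
  altSum (outside ∷ Q) g +ℚ sumList (map (signedTerm g) (map (inside ∷_) Ts))
    ≡⟨ cong₂ _+ℚ_ (altSum-outside Q g) (signedSum-inside g Ts) ⟩
  altSum Q (λ T → g (outside ∷ T)) +ℚ - altSum Q (λ T → g (inside ∷ T)) ∎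
  where Ts = subsetsOf Q

altSum-zero : ∀ {n} (Q : Subset n) {g : Subset n → ℚ} → (∀ T → g T ≡ 0ℚ) → altSum Q g ≡ 0ℚ
altSum-zero []            g≗0 = cong (λ v → sgn 0 *ℚ v +ℚ 0ℚ) (g≗0 [])
altSum-zero (false ∷ Q) {g} g≗0 =
  trans (altSum-outside Q g) (altSum-zero Q (λ T → g≗0 (outside ∷ T)))
altSum-zero (true ∷ Q)  {g} g≗0 =
  trans (altSum-inside Q g)
        (cong₂ (λ u v → u +ℚ - v) (altSum-zero Q (λ T → g≗0 (outside ∷ T))) (altSum-zero Q (λ T → g≗0 (inside ∷ T))))

altSum-∩-∁ : ∀ {n} (Q C : Subset n) (g : Subset n → ℚ) →
             altSum Q (λ T → if disjoint? T C then g T else 0ℚ) ≡ altSum (Q ∩ ∁ C) g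
altSum-∩-∁ []          []          g = refl
altSum-∩-∁ (false ∷ Q) (c ∷ C)     g = begin
  altSum (outside ∷ Q) _                          ≡⟨ altSum-outside Q _ ⟩
  altSum Q _                                      ≡⟨ altSum-∩-∁ Q C (λ T → g (outside ∷ T)) ⟩
  altSum (Q ∩ ∁ C) (λ T → g (outside ∷ T))        ≡⟨ altSum-outside (Q ∩ ∁ C) g ⟨
  altSum (outside ∷ Q ∩ ∁ C) g                    ∎
altSum-∩-∁ (true ∷ Q)  (true ∷ C)  g = begin
  altSum (inside ∷ Q) _                           ≡⟨ altSum-inside Q _ ⟩
  altSum Q _ +ℚ - altSum Q (λ _ → 0ℚ)             ≡⟨ cong (λ v → altSum Q _ +ℚ - v) (altSum-zero Q (λ _ → refl)) ⟩
  altSum Q _ +ℚ 0ℚ                                ≡⟨ +-identityʳ _ ⟩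
  altSum Q _                                      ≡⟨ altSum-∩-∁ Q C (λ T → g (outside ∷ T)) ⟩
  altSum (Q ∩ ∁ C) (λ T → g (outside ∷ T))        ≡⟨ altSum-outside (Q ∩ ∁ C) g ⟨
  altSum (outside ∷ Q ∩ ∁ C) g                    ∎
altSum-∩-∁ (true ∷ Q)  (false ∷ C) g = begin
  altSum (inside ∷ Q) _                           ≡⟨ altSum-inside Q _ ⟩
  altSum Q _ +ℚ - altSum Q _                      ≡⟨ cong₂ (λ u v → u +ℚ - v) (altSum-∩-∁ Q C (λ T → g (outside ∷ T)))
                                                                           (altSum-∩-∁ Q C (λ T → g (inside ∷ T))) ⟩
  altSum (Q ∩ ∁ C) (λ T → g (outside ∷ T)) +ℚ - altSum (Q ∩ ∁ C) (λ T → g (inside ∷ T))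
                                                  ≡⟨ altSum-inside (Q ∩ ∁ C) g ⟨
  altSum (inside ∷ Q ∩ ∁ C) g                     ∎

disjoint?-∅ : ∀ {n} (C : Subset n) → disjoint? ∅ C ≡ true
disjoint?-∅ []      = refl
disjoint?-∅ (c ∷ C) = disjoint?-∅ C

disjoint?-∪ : ∀ {n} (S T C : Subset n) → disjoint? (S ∪ T) C ≡ disjoint? S C ∧ disjoint? T C
disjoint?-∪ []          []          []          = refl
disjoint?-∪ (true ∷ S)  (t ∷ T)     (true ∷ C)  = refl
disjoint?-∪ (false ∷ S) (true ∷ T)  (true ∷ C)  = sym (∧-zeroʳ (disjoint? S C))
disjoint?-∪ (false ∷ S) (false ∷ T) (c ∷ C)     = disjoint?-∪ S T C
disjoint?-∪ (true ∷ S)  (true ∷ T)  (false ∷ C) = disjoint?-∪ S T C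
disjoint?-∪ (true ∷ S)  (false ∷ T) (false ∷ C) = disjoint?-∪ S T C
disjoint?-∪ (false ∷ S) (true ∷ T)  (false ∷ C) = disjoint?-∪ S T C

disjoint?-⁅⁆ : ∀ {n} (i : Fin n) (C : Subset n) → disjoint? ⁅ i ⁆ C ≡ not (lookup C i)
disjoint?-⁅⁆ zero    (true ∷ C)  = refl
disjoint?-⁅⁆ zero    (false ∷ C) = disjoint?-∅ C
disjoint?-⁅⁆ (suc i) (c ∷ C)     = disjoint?-⁅⁆ i C

disjoint?⇒⊆∁ : ∀ {n} {S C : Subset n} → disjoint? S C ≡ true → S ⊆ ∁ C
disjoint?⇒⊆∁ {S = true ∷ S}  {false ∷ C} S#C here       = here
disjoint?⇒⊆∁ {S = true ∷ S}  {false ∷ C} S#C (there x∈S) = there (disjoint?⇒⊆∁ S#C x∈S)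
disjoint?⇒⊆∁ {S = false ∷ S} {c ∷ C}     S#C (there x∈S) = there (disjoint?⇒⊆∁ S#C x∈S)

disjoint?-∪-⁅⁆ : ∀ {n} (S T : Subset n) (i : Fin n) (C : Subset n) →
                 disjoint? (S ∪ T ∪ ⁅ i ⁆) C ≡ disjoint? S C ∧ disjoint? T C ∧ not (lookup C i)
disjoint?-∪-⁅⁆ S T i C = begin
  disjoint? (S ∪ T ∪ ⁅ i ⁆) C                        ≡⟨ disjoint?-∪ S (T ∪ ⁅ i ⁆) C ⟩
  disjoint? S C ∧ disjoint? (T ∪ ⁅ i ⁆) C            ≡⟨ cong (disjoint? S C ∧_) (disjoint?-∪ T ⁅ i ⁆ C) ⟩
  disjoint? S C ∧ disjoint? T C ∧ disjoint? ⁅ i ⁆ C  ≡⟨ cong (λ d → disjoint? S C ∧ disjoint? T C ∧ d) (disjoint?-⁅⁆ i C) ⟩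
  disjoint? S C ∧ disjoint? T C ∧ not (lookup C i)   ∎

∩-∅-∩ʳ : ∀ {n} (S Q R : Subset n) → S ∩ Q ≡ ∅ → S ∩ (Q ∩ R) ≡ ∅
∩-∅-∩ʳ S Q R S∩Q≡∅ = begin
  S ∩ (Q ∩ R)  ≡⟨ ∩-assoc S Q R ⟨
  (S ∩ Q) ∩ R  ≡⟨ cong (_∩ R) S∩Q≡∅ ⟩
  ∅ ∩ R        ≡⟨ ∩-zeroˡ R ⟩
  ∅            ∎

zeroCoeffsOn : ∀ {n} → Subset n → Vec ℚ n → Vec ℚ n
zeroCoeffsOn C a = tabulate (λ i → if lookup C i then 0ℚ else lookup a i)

∈-removeVars : ∀ {n} (C : Subset n) {sys : System n} {a b} →
               (a , b) ∈ sys → (zeroCoeffsOn C a , b) ∈ removeVars C sys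
∈-removeVars C = ∈-map⁺ _

altSum-extendByZero : ∀ {n} (C : Subset n) (y : Subset n → ℚ) (Q : Subset n) (V : Subset n → Subset n) →
                      (∀ T → disjoint? (V T) C ≡ disjoint? T C) →
                      altSum Q (λ T → extendByZero C y (V T)) ≡ altSum (Q ∩ ∁ C) (λ T → y (V T))
altSum-extendByZero C y Q V V#C≡T#C =
  trans (altSum-cong Q (λ T → cong (if_then y (V T) else 0ℚ) (V#C≡T#C T))) (altSum-∩-∁ Q C (λ T → y (V T)))

altSum-extendByZero-meets : ∀ {n} (C : Subset n) (y : Subset n → ℚ) (Q : Subset n) (V : Subset n → Subset n) →
                            (∀ T → disjoint? (V T) C ≡ false) →
                            altSum Q (λ T → extendByZero C y (V T)) ≡ 0ℚ
altSum-extendByZero-meets C y Q V V#C≡false =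
  altSum-zero Q (λ T → cong (if_then y (V T) else 0ℚ) (V#C≡false T))

SA-lhs : ∀ {n} → ℚ → (Subset n → ℚ) → Subset n → Subset n → ℚ
SA-lhs b y S Q = b *ℚ altSum Q (λ T → y (S ∪ T))

SA-rhs : ∀ {n} → Subset n → Vec ℚ n → (Subset n → ℚ) → Subset n → Subset n → ℚ
SA-rhs I a y S Q = Σ-in I (λ i → lookup a i *ℚ altSum Q (λ T → y (S ∪ T ∪ ⁅ i ⁆)))

module _ {n} (C : Subset n) (y : Subset n → ℚ) {S : Subset n} (Q : Subset n) where

  SA-lhs-meets : ∀ b → disjoint? S C ≡ false → SA-lhs b (extendByZero C y) S Q ≡ 0ℚ
  SA-lhs-meets b S#C≡false =
    trans (cong (b *ℚ_) (altSum-extendByZero-meets C y Q (S ∪_) (λ T → trans (disjoint?-∪ S T C) (cong (_∧ _) S#C≡false))))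
          (*-zeroʳ b)

  SA-rhs-meets : ∀ I a → disjoint? S C ≡ false → SA-rhs I a (extendByZero C y) S Q ≡ 0ℚ
  SA-rhs-meets I a S#C≡false = Σ-in-zero I (λ i →
    trans (cong (lookup a i *ℚ_) (altSum-extendByZero-meets C y Q (λ T → S ∪ T ∪ ⁅ i ⁆)
                                    (λ T → trans (disjoint?-∪ S _ C) (cong (_∧ _) S#C≡false))))
          (*-zeroʳ (lookup a i)))

  SA-lhs-extendByZero : ∀ b → disjoint? S C ≡ true → SA-lhs b (extendByZero C y) S Q ≡ SA-lhs b y S (Q ∩ ∁ C)
  SA-lhs-extendByZero b S#C =
    cong (b *ℚ_) (altSum-extendByZero C y Q (S ∪_) (λ T → trans (disjoint?-∪ S T C) (cong (_∧ _) S#C)))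

  SA-rhs-extendByZero : ∀ a → disjoint? S C ≡ true →
                        SA-rhs ⊤ a (extendByZero C y) S Q ≡ SA-rhs (∁ C) (zeroCoeffsOn C a) y S (Q ∩ ∁ C)
  SA-rhs-extendByZero a S#C = Σ-in-⊤-∁ C termwise
    where
    ∪-⁅⁆#C : ∀ i T → disjoint? (S ∪ T ∪ ⁅ i ⁆) C ≡ disjoint? T C ∧ not (lookup C i)
    ∪-⁅⁆#C i T = trans (disjoint?-∪-⁅⁆ S T i C) (cong (_∧ _) S#C)

    termwise : ∀ i → lookup a i *ℚ altSum Q (λ T → extendByZero C y (S ∪ T ∪ ⁅ i ⁆))
                     ≡ (if lookup C i then 0ℚ
                        else lookup (zeroCoeffsOn C a) i *ℚ altSum (Q ∩ ∁ C) (λ T → y (S ∪ T ∪ ⁅ i ⁆)))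
    termwise i rewrite lookup∘tabulate (λ j → if lookup C j then 0ℚ else lookup a j) i with lookup C i in i∈C
    ... | true  = trans (cong (lookup a i *ℚ_) (altSum-extendByZero-meets C y Q (λ T → S ∪ T ∪ ⁅ i ⁆)
                          (λ T → trans (∪-⁅⁆#C i T) (trans (cong (λ c → disjoint? T C ∧ not c) i∈C) (∧-zeroʳ _)))))
                        (*-zeroʳ (lookup a i))
    ... | false = cong (lookup a i *ℚ_) (altSum-extendByZero C y Q (λ T → S ∪ T ∪ ⁅ i ⁆)
                          (λ T → trans (∪-⁅⁆#C i T) (trans (cong (λ c → disjoint? T C ∧ not c) i∈C) (∧-identityʳ _))))

proposition1 : ∀ (n : ℕ) (sys : System n) (C : Subset n) (t : ℕ) →
    ContainsBox sys →
    NoPositiveSupportIn sys C →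
    ∀ (y : Subset n → ℚ) →
    SA (∁ C) (removeVars C sys) t y →
    SA ⊤ sys t (extendByZero C y)
proposition1 n sys C t _ _ y (y∅≡1 , feasible) = y′∅≡1 , feasible′
  where
  y′∅≡1 : extendByZero C y ∅ ≡ 1ℚ
  y′∅≡1 rewrite disjoint?-∅ C = y∅≡1

  feasible′ : ∀ {a b} → (a , b) ∈ sys → ∀ (S Q : Subset n) → S ⊆ ⊤ → Q ⊆ ⊤ → S ∩ Q ≡ ∅ → ∣ S ∣ + ∣ Q ∣ ≤ t →
              SA-lhs b (extendByZero C y) S Q ≤ℚ SA-rhs ⊤ a (extendByZero C y) S Q
  feasible′ {a} {b} ab∈sys S Q _ _ S∩Q≡∅ |S|+|Q|≤t with disjoint? S C in S#C
  ... | false = ≤-reflexive (trans (SA-lhs-meets C y Q b S#C) (sym (SA-rhs-meets C y Q ⊤ a S#C)))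
  ... | true  = subst₂ _≤ℚ_ (sym (SA-lhs-extendByZero C y Q b S#C)) (sym (SA-rhs-extendByZero C y Q a S#C))
                  (feasible (∈-removeVars C ab∈sys) S (Q ∩ ∁ C) (disjoint?⇒⊆∁ S#C) (p∩q⊆q Q (∁ C))
                            (∩-∅-∩ʳ S Q (∁ C) S∩Q≡∅)
                            (ℕ.≤-trans (ℕ.+-monoʳ-≤ ∣ S ∣ (∣p∩q∣≤∣p∣ Q (∁ C))) |S|+|Q|≤t))
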